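{- Given a graph $G=(L,w,E)$, two properties $\phi_{1}$ and $\phi_{2}$, a trace $\vec x$ and a location $\ell$, let $s_{\psi, \ell}=\mathrm{BoolSurround}(G, \vec x, \phi_{1}, \phi_{2}, \ell)$ and let ${\mathcal{I}}_{s_{\psi,\ell}}$ be the minimal interval covering consistent with $\{s_{\phi_{1},\ell'}, s_{\phi_{2},\ell'}\}_{\ell' \in L^{\ell}_{[0,d_{2}]}}$. Then, for all $I_{i}\in {\mathcal{I}}_{s_{\psi,\ell}}$, $$s_{\psi, \ell}(I_{i}) = 1 \iff (\vec x, t, \ell) \models \phi_{1}\,\mathcal{S}_{[d_{1},d_{2}]}\,\phi_{2} \quad \forall t \in I_{i}.$$
   Context: Space is a weighted undirected graph $G=(L,E,w)$ with finite nonempty set of locations $L$, symmetric edge relation $E\subseteq L\times L$ and positive weights $w:E\to\mathbb{R}_{>0}$; $d(\ell,\ell')$ is the shortest-path weighted distance, and $L^{\ell}_{[a,b]}=\{\ell' \in L : a\le d(\ell,\ell')\le b\}$. The external boundary of $A\subseteq L$ is $B^{+}(A)=\{\ell\notin A : \exists \ell'\in A,\ (\ell',\ell)\in E\}$. A spatio-temporal trace $\vec x:[0,T]\times L\to\mathbb{R}^n$ is given; for each subformula $\phi$ and location $\ell'$, $s_{\phi,\ell'}:[0,T]\to\{0,1\}$ is the Boolean signal with $s_{\phi,\ell'}(t)=1$ iff $(\vec x,t,\ell')\models\phi$. The bounded surrounded operator has Boolean semantics: $(\vec x,t,\ell)\models \phi_1\,\mathcal{S}_{[d_1,d_2]}\,\phi_2$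 iff there exists $A\subseteq L^{\ell}_{[0,d_2]}$ with $\ell\in A$, every $\ell'\in A$ satisfies $\phi_1$ at $t$, $B^{+}(A)\subseteq L^{\ell}_{[d_1,d_2]}$, and every $\ell''\in B^{+}(A)$ satisfies $\phi_2$ at $t$. The minimal interval covering of a time interval consistent with a set of Boolean signals is the shortest finite sequence of pairwise disjoint left-closed right-open intervals covering it on each of which every signal is constant. BoolSurround (Boolean monitoring algorithm for $\psi=\phi_1\,\mathcal{S}_{[d_1,d_2]}\,\phi_2$ at location $\ell$): computes $s_{\phi_1,\ell'},s_{\phi_2,\ell'}$ for $\ell'\in L^{\ell}_{[0,d_2]}$ and their minimal interval covering; for each interval $I_i$ it sets $V=\{\ell'\in L^{\ell}_{[0,d_2]} : s_{\phi_1,\ell'}(I_i)=1\}$, $Q=\{\ell'\in L^{\ell}_{[d_1,d_2]} : s_{\phi_2,\ell'}(I_i)=1\}$, $W=B^{+}(Q\cup V)$; while $W\neq\emptyset$, for each $u\in W$ it removes from $V$ the set $N$ of elements of $V$ adjacent to $u$ and collects $N\setminus Q$ into the next $W$; finally $s_{\psi,\ell}(I_i)=1$ iff $\ell\in V$, then merges adjacent positive intervals.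
   Formalization: Time, the horizon T, the edge weights and the distance bounds d₁, d₂ are rational rather than real. -}

module Defs where

open import Data.Nat as ℕ using (ℕ; zero; suc)
open import Data.Fin using (Fin)
open import Data.Bool using (Bool; true; false; _∧_; _∨_; not; T; if_then_else_)
open import Data.Rational using (ℚ; 0ℚ; _≤_; _<_; _+_; _≤?_)
open import Data.List using (List; []; _∷_; foldl; length; filterᵇ; allFin; lookup)
open import Data.Bool.ListAction using (any)
open import Data.Product using (Σ; _×_; _,_; ∃)
open import Relation.Nullary using (¬_)
open import Relation.Nullary.Decidable using (⌊_⌋)
open import Relation.Binary.PropositionalEquality using (_≡_)

-- Weighted undirected graph on the finite location set L = Fin k.
-- Edges are given by a (decidable) symmetric relation E, weights w are
-- positive rationals on edges (FIDELITY: ℚ instead of ℝ).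

record WGraph (k : ℕ) : Set where
  field
    E     : Fin k → Fin k → Bool
    w     : Fin k → Fin k → ℚ
    E-sym : ∀ a b → E a b ≡ E b a
    w-sym : ∀ a b → T (E a b) → w a b ≡ w b a
    w-pos : ∀ a b → T (E a b) → 0ℚ < w a b
open WGraph public

data Path {k : ℕ} (G : WGraph k) : Fin k → Fin k → ℚ → Set where
  here : ∀ a → Path G a a 0ℚ
  step : ∀ {a b c r} → T (E G a b) → Path G b c r → Path G a c (w G a b + r)

data Dist : Set where
  fin : ℚ → Dist
  ∞   : Dist

IsShortestDist : ∀ {k} → WGraph k → (Fin k → Fin k → Dist) → Set
IsShortestDist {k} G d = ∀ a b → Spec a b (d a b)
  where
  Spec : Fin k → Fin k → Dist → Set
  Spec a b (fin δ) = Path G a b δ × (∀ r → Path G a b r → δ ≤ r)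
  Spec a b ∞       = ∀ r → ¬ Path G a b r

inRange : ∀ {k} → (Fin k → Fin k → Dist) → Fin k → ℚ → ℚ → Fin k → Bool
inRange d ℓ lo hi ℓ' with d ℓ ℓ'
... | fin δ = ⌊ lo ≤? δ ⌋ ∧ ⌊ δ ≤? hi ⌋
... | ∞     = false

LSet : ℕ → Set
LSet k = Fin k → Bool

boundary : ∀ {k} → WGraph k → LSet k → LSet k
boundary {k} G A u = not (A u) ∧ any (λ v → A v ∧ E G v u) (allFin k)

-- Boolean semantics of the bounded surround operator, in terms of the
-- Boolean signals s₁ = s_{φ₁,·}, s₂ = s_{φ₂,·} (time domain ℚ).

SurroundSat : ∀ {k} → WGraph k → (Fin k → Fin k → Dist) →
              (s₁ s₂ : Fin k → ℚ → Bool) → (d₁ d₂ : ℚ) → ℚ → Fin k → Set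
SurroundSat {k} G d s₁ s₂ d₁ d₂ t ℓ =
  Σ (LSet k) λ A →
      (∀ l → T (A l) → T (inRange d ℓ 0ℚ d₂ l))
    × T (A ℓ)
    × (∀ l → T (A l) → T (s₁ l t))
    × (∀ l → T (boundary G A l) → T (inRange d ℓ d₁ d₂ l))
    × (∀ l → T (boundary G A l) → T (s₂ l t))

processU : ∀ {k} → WGraph k → LSet k → LSet k × LSet k → Fin k → LSet k × LSet k
processU G Q (V , Wn) u =
  (λ v → V v ∧ not (V v ∧ E G u v)) ,
  (λ v → Wn v ∨ ((V v ∧ E G u v) ∧ not (Q v)))

round : ∀ {k} → WGraph k → LSet k → LSet k → LSet k → LSet k × LSet k
round {k} G Q V W = foldl (processU G Q) (V , (λ _ → false)) (filterᵇ W (allFin k))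

isEmpty : ∀ {k} → LSet k → Bool
isEmpty {k} W = not (any W (allFin k))

-- while W ≠ ∅ loop, with a fuel bound that is never reached before
-- W becomes empty (each non-final pass strictly shrinks V).
loop : ∀ {k} → WGraph k → LSet k → ℕ → LSet k → LSet k → LSet k
loop G Q zero    V W = V
loop G Q (suc f) V W with isEmpty W
... | true  = V
... | false with round G Q V W
...   | (V' , W') = loop G Q f V' W'

-- Algorithm result for ψ = φ₁ S_[d₁,d₂] φ₂ at ℓ, with signal values read at time t
-- (t a point of the interval I_i, on which all relevant signals are constant).
boolSurroundAt : ∀ {k} → WGraph k → (Fin k → Fin k → Dist) →
                 (s₁ s₂ : Fin k → ℚ → Bool) → (d₁ d₂ : ℚ) → Fin k → ℚ → Bool
boolSurroundAt {k} G d s₁ s₂ d₁ d₂ ℓ t = loop G Q (suc (suc k)) V W ℓ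
  where
  V : LSet k
  V l = inRange d ℓ 0ℚ d₂ l ∧ s₁ l t
  Q : LSet k
  Q l = inRange d ℓ d₁ d₂ l ∧ s₂ l t
  W : LSet k
  W = boundary G (λ l → Q l ∨ V l)

Interval : Set
Interval = ℚ × ℚ

lo : Interval → ℚ
lo (a , _) = a

_∈I[_]_ : ℚ → ℚ → Interval → Set
t ∈I[ Tm ] (a , b) = (0ℚ ≤ t × t ≤ Tm) × (a ≤ t × t < b)

record IsConsistentCovering {k} (d : Fin k → Fin k → Dist) (s₁ s₂ : Fin k → ℚ → Bool)
         (d₂ : ℚ) (ℓ : Fin k) (Tm : ℚ) (cov : List Interval) : Set where
  field
    wf       : ∀ i → let (a , b) = lookup cov i in (0ℚ ≤ a × a ≤ Tm) × a < b
    covers   : ∀ t → 0ℚ ≤ t → t ≤ Tm → ∃ λ i → t ∈I[ Tm ] lookup cov i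
    disjoint : ∀ i j t → t ∈I[ Tm ] lookup cov i → t ∈I[ Tm ] lookup cov j → i ≡ j
    constant : ∀ i l → T (inRange d ℓ 0ℚ d₂ l) → ∀ t t' →
               t ∈I[ Tm ] lookup cov i → t' ∈I[ Tm ] lookup cov i →
               (s₁ l t ≡ s₁ l t') × (s₂ l t ≡ s₂ l t')

IsMinimalCovering : ∀ {k} (d : Fin k → Fin k → Dist) (s₁ s₂ : Fin k → ℚ → Bool)
         (d₂ : ℚ) (ℓ : Fin k) (Tm : ℚ) (cov : List Interval) → Set
IsMinimalCovering d s₁ s₂ d₂ ℓ Tm cov =
  IsConsistentCovering d s₁ s₂ d₂ ℓ Tm cov ×
  (∀ cov' → IsConsistentCovering d s₁ s₂ d₂ ℓ Tm cov' → length cov ℕ.≤ length cov')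

sψ : ∀ {k} → WGraph k → (Fin k → Fin k → Dist) →
     (s₁ s₂ : Fin k → ℚ → Bool) → (d₁ d₂ : ℚ) → Fin k → Interval → Bool
sψ G d s₁ s₂ d₁ d₂ ℓ I = boolSurroundAt G d s₁ s₂ d₁ d₂ ℓ (lo I)

{-# OPTIONS --safe #-}
module Submission where

-- On each interval of the covering all signals read by the semantics are constant, so both sides
-- can be evaluated at the left endpoint. There, with V the φ₁-locations of L^ℓ_[0,d₂] and Q the
-- φ₂-locations of L^ℓ_[d₁,d₂], the surround holds at ℓ iff ℓ lies in some A ⊆ V with B⁺(A) ⊆ Q,
-- and the loop computes the largest such A. It never removes a point of such an A: the locations
-- in W lie outside A ∪ Q, so none of them is adjacent to A, as it would then lie in B⁺(A) ⊆ Q.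
-- Conversely, every location of B⁺(V) outside Q is always waiting in W, so once W runs empty the
-- remaining V satisfies B⁺(V) ⊆ Q. A round that collects anything strictly shrinks V, so the
-- fuel k + 2 of the loop is never exhausted early.

open import Defs
open import Data.Bool using (Bool; true; false; T; not; _∧_; _∨_)
open import Data.Bool.Properties using (T-∧; T-∨; T-≡; ∧-identityʳ)
open import Data.Bool.ListAction using (any)
open import Data.Empty using (⊥-elim)
open import Data.Fin using (Fin)
import Data.Fin.Subset as Subset
open import Data.Fin.Subset.Properties using (p⊂q⇒∣p∣<∣q∣; ∣p∣≤n)
open import Data.List using (List; []; _∷_; foldl; filterᵇ; allFin; length; lookup)
open import Data.List.Membership.Propositional using (lose; find)
open import Data.List.Membership.Propositional.Properties using (∈-allFin; ∈-filter⁺; ∈-filter⁻)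
open import Data.List.Relation.Unary.Any using (satisfied)
open import Data.List.Relation.Unary.Any.Properties using (any⁺; any⁻)
open import Data.Nat as ℕ using (ℕ; zero; suc; s≤s)
open import Data.Nat.Properties using (<-≤-trans; m≤n⇒m≤1+n)
open import Data.Product using (∃-syntax; _×_; _,_; proj₁; proj₂)
open import Data.Rational using (ℚ; 0ℚ; _≤_)
import Data.Rational.Properties as ℚ
open import Data.Sum using (_⊎_; inj₁; inj₂; [_,_])
open import Data.Vec using (tabulate)
open import Data.Vec.Properties using (lookup∘tabulate; lookup⇒[]=; []=⇒lookup)
open import Function using (_∘_)
open import Function.Bundles using (_⇔_; mk⇔; Equivalence)
open import Relation.Nullary using (¬_; yes; no)
open import Relation.Nullary.Decidable using (T?; ⌊_⌋; toWitness; fromWitness)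
open import Relation.Binary.PropositionalEquality using (_≡_; refl; sym; trans; subst)

open Equivalence using (to; from)

T-not : ∀ {b} → T (not b) ⇔ (¬ T b)
T-not {true}  = mk⇔ (λ ()) (λ ¬t → ¬t _)
T-not {false} = mk⇔ (λ _ ()) _

T-∧-not : ∀ {a b} → T (a ∧ not b) ⇔ (T a × ¬ T b)
T-∧-not {true}  = mk⇔ (λ t → _ , to T-not t) (λ (_ , ¬t) → from T-not ¬t)
T-∧-not {false} = mk⇔ (λ ()) proj₁

module _ {k : ℕ} where

  _⊆_ : LSet k → LSet k → Set
  A ⊆ B = ∀ x → T (A x) → T (B x)

  Disjoint : LSet k → LSet k → Set
  Disjoint A B = ∀ x → T (A x) → ¬ T (B x)

  T-any-allFin : ∀ (p : Fin k → Bool) → T (any p (allFin k)) ⇔ (∃[ x ] T (p x))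
  T-any-allFin p = mk⇔
    (λ t → satisfied (any⁻ p (allFin k) t))
    (λ (x , px) → any⁺ p (lose (∈-allFin x) px))

  isEmpty≡true⇒∉ : ∀ {W} → isEmpty W ≡ true → ∀ x → ¬ T (W x)
  isEmpty≡true⇒∉ {W} empty x w = to T-not (from T-≡ empty) (from (T-any-allFin W) (x , w))

  isEmpty≡false⇒∈ : ∀ {W} → isEmpty W ≡ false → ∃[ x ] T (W x)
  isEmpty≡false⇒∈ {W} _ with any W (allFin k) in t
  ... | true = to (T-any-allFin W) (from T-≡ t)

  size : LSet k → ℕ
  size A = Subset.∣ tabulate A ∣

  ∈-tabulate⇔ : ∀ {A : LSet k} {x} → T (A x) ⇔ x Subset.∈ tabulate A
  ∈-tabulate⇔ {A} {x} = mk⇔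
    (λ a → lookup⇒[]= {x = true} x (tabulate A) (trans (lookup∘tabulate A x) (to T-≡ a)))
    (λ m → from T-≡ (trans (sym (lookup∘tabulate A x)) ([]=⇒lookup {xs = tabulate A} m)))

  size-< : ∀ {A B} → B ⊆ A → ∀ x → T (A x) → ¬ T (B x) → size B ℕ.< size A
  size-< {A} {B} B⊆A x x∈A x∉B = p⊂q⇒∣p∣<∣q∣ {p = tabulate B} {q = tabulate A}
    ( (λ m → to ∈-tabulate⇔ (B⊆A _ (from ∈-tabulate⇔ m)))
    , x , to ∈-tabulate⇔ x∈A , (λ m → x∉B (from ∈-tabulate⇔ m)) )

  size≤ : ∀ A → size A ℕ.≤ k
  size≤ A = ∣p∣≤n (tabulate A)

module _ {k} (G : WGraph k) where

  Adjacent : LSet k → Fin k → Set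
  Adjacent A v = ∃[ u ] T (A u) × T (E G u v)

  E-symᵀ : ∀ {u v} → T (E G u v) → T (E G v u)
  E-symᵀ {u} {v} = subst T (E-sym G u v)

  boundary⇔ : ∀ {A u} → T (boundary G A u) ⇔ (¬ T (A u) × Adjacent A u)
  boundary⇔ {A} {u} = mk⇔
    (λ b → let (u∉A , adj) = to T-∧ b; (v , v∈A∧e) = to (T-any-allFin _) adj in
           to T-not u∉A , v , to T-∧ v∈A∧e)
    (λ (u∉A , v , v∈A , e) →
       from T-∧ (from T-not u∉A , from (T-any-allFin _) (v , from T-∧ (v∈A , e))))

private
  kept-nil : ∀ a → a ≡ a ∧ not false
  kept-nil a = sym (∧-identityʳ a)

  kept-cons : ∀ a e n → (a ∧ not (a ∧ e)) ∧ not n ≡ a ∧ not (e ∨ n)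
  kept-cons true  true  n = refl
  kept-cons true  false n = refl
  kept-cons false e     n = refl

  collected-nil : ∀ w a q → w ≡ w ∨ (a ∧ false) ∧ not q
  collected-nil true  a     q = refl
  collected-nil false true  q = refl
  collected-nil false false q = refl

  collected-cons : ∀ w a e n q →
    (w ∨ (a ∧ e) ∧ not q) ∨ ((a ∧ not (a ∧ e)) ∧ n) ∧ not q ≡ w ∨ (a ∧ (e ∨ n)) ∧ not q
  collected-cons true  a     e     n q     = refl
  collected-cons false false e     n q     = refl
  collected-cons false true  true  n true  = refl
  collected-cons false true  true  n false = refl
  collected-cons false true  false n q     = refl

module Peeling {k} (G : WGraph k) (Q : LSet k) where

  adjacentᵇ : List (Fin k) → LSet k
  adjacentᵇ us v = any (λ u → E G u v) us

  foldl-processU : ∀ us V Wn v →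
    let (V′ , Wn′) = foldl (processU G Q) (V , Wn) us in
    V′ v ≡ V v ∧ not (adjacentᵇ us v) × Wn′ v ≡ Wn v ∨ (V v ∧ adjacentᵇ us v) ∧ not (Q v)
  foldl-processU []       V Wn v = kept-nil (V v) , collected-nil (Wn v) (V v) (Q v)
  foldl-processU (u ∷ us) V Wn v =
    let (kept , collected) = foldl-processU us _ _ v in
    trans kept (kept-cons (V v) (E G u v) (adjacentᵇ us v)) ,
    trans collected (collected-cons (Wn v) (V v) (E G u v) (adjacentᵇ us v) (Q v))

  neighbourᵇ : LSet k → LSet k
  neighbourᵇ W = adjacentᵇ (filterᵇ W (allFin k))

  T-neighbourᵇ : ∀ {W v} → T (neighbourᵇ W v) ⇔ Adjacent G W v
  T-neighbourᵇ {W} {v} = mk⇔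
    (λ t → let (u , u∈ , e) = find (any⁻ _ (filterᵇ W (allFin k)) t) in
           u , proj₂ (∈-filter⁻ (λ u → T? (W u)) {xs = allFin k} u∈) , e)
    (λ (u , w , e) → any⁺ _ (lose (∈-filter⁺ (λ u → T? (W u)) (∈-allFin u) w) e))

  round-keptᵇ : ∀ V W v → proj₁ (round G Q V W) v ≡ V v ∧ not (neighbourᵇ W v)
  round-keptᵇ V W v = proj₁ (foldl-processU (filterᵇ W (allFin k)) V (λ _ → false) v)

  round-collectedᵇ : ∀ V W v → proj₂ (round G Q V W) v ≡ (V v ∧ neighbourᵇ W v) ∧ not (Q v)
  round-collectedᵇ V W v = proj₂ (foldl-processU (filterᵇ W (allFin k)) V (λ _ → false) v)

  module _ {V W : LSet k} where

    round-kept : ∀ {v} → T (proj₁ (round G Q V W) v) ⇔ (T (V v) × ¬ Adjacent G W v)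
    round-kept {v} = mk⇔
      (λ t → let (v∈V , ¬adj) = to T-∧-not (subst T (round-keptᵇ V W v) t) in
             v∈V , λ adj → ¬adj (from T-neighbourᵇ adj))
      (λ (v∈V , ¬adj) → subst T (sym (round-keptᵇ V W v))
                          (from T-∧-not (v∈V , λ t → ¬adj (to T-neighbourᵇ t))))

    round-collected : ∀ {v} →
      T (proj₂ (round G Q V W) v) ⇔ ((T (V v) × Adjacent G W v) × ¬ T (Q v))
    round-collected {v} = mk⇔
      (λ t → let (v∈V∧adj , v∉Q) = to T-∧-not (subst T (round-collectedᵇ V W v) t)
                 (v∈V , adj) = to T-∧ v∈V∧adj in
             (v∈V , to T-neighbourᵇ adj) , v∉Q)
      (λ ((v∈V , adj) , v∉Q) → subst T (sym (round-collectedᵇ V W v))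
                                 (from T-∧-not (from T-∧ (v∈V , from T-neighbourᵇ adj) , v∉Q)))

    round-removed : ∀ {v} → T (V v) → ¬ T (proj₁ (round G Q V W) v) → Adjacent G W v
    round-removed {v} v∈V ¬kept with T? (neighbourᵇ W v)
    ... | yes adj = to T-neighbourᵇ adj
    ... | no ¬adj = ⊥-elim (¬kept (from round-kept (v∈V , λ adj → ¬adj (from T-neighbourᵇ adj))))

    round-shrinks : ∀ x → T (proj₂ (round G Q V W) x) →
                    size (proj₁ (round G Q V W)) ℕ.< size V
    round-shrinks x collected =
      let ((x∈V , adj) , _) = to round-collected collected in
      size-< (λ _ kept → proj₁ (to round-kept kept)) x x∈V (λ kept → proj₂ (to round-kept kept) adj)

  -- Out of fuel, the loop returns V as it stands, which is harmless once W is empty.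
  loop-invariant : (P : LSet k → LSet k → Set) →
    (∀ {V W} → P V W → P (proj₁ (round G Q V W)) (proj₂ (round G Q V W))) →
    ∀ f V W → size V ℕ.< f ⊎ isEmpty W ≡ true → P V W →
    ∃[ W∞ ] P (loop G Q f V W) W∞ × isEmpty W∞ ≡ true
  loop-invariant P preserved zero    V W (inj₁ ())    p
  loop-invariant P preserved zero    V W (inj₂ empty) p = W , p , empty
  loop-invariant P preserved (suc f) V W fuel         p with isEmpty W in empty
  ... | true = W , p , empty
  ... | false with fuel
  ...   | inj₁ (s≤s size≤f) = loop-invariant P preserved f _ _ fuel′ (preserved p)
    where
    fuel′ : size (proj₁ (round G Q V W)) ℕ.< f ⊎ isEmpty (proj₂ (round G Q V W)) ≡ true
    fuel′ with isEmpty (proj₂ (round G Q V W)) in empty′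
    ... | true  = inj₂ refl
    ... | false = let (x , collected) = isEmpty≡false⇒∈ empty′ in
                  inj₁ (<-≤-trans (round-shrinks x collected) size≤f)

  peel : LSet k → LSet k
  peel V = loop G Q (suc (suc k)) V (boundary G (λ l → Q l ∨ V l))

  peel-invariant : (P : LSet k → LSet k → Set) →
    (∀ {V W} → P V W → P (proj₁ (round G Q V W)) (proj₂ (round G Q V W))) →
    ∀ V → P V (boundary G (λ l → Q l ∨ V l)) → ∃[ W∞ ] P (peel V) W∞ × isEmpty W∞ ≡ true
  peel-invariant P preserved V =
    loop-invariant P preserved (suc (suc k)) V _ (inj₁ (s≤s (m≤n⇒m≤1+n (size≤ V))))

  Exposed : LSet k → LSet k → Set
  Exposed V W = ∀ x → T (boundary G V x) → ¬ T (Q x) → T (W x)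

  exposed-initial : ∀ V → Exposed V (boundary G (λ l → Q l ∨ V l))
  exposed-initial V x b ¬q =
    let (x∉V , v , v∈V , e) = to (boundary⇔ G) b in
    from (boundary⇔ G) ([ ¬q , x∉V ] ∘ to T-∨ , v , from T-∨ (inj₂ v∈V) , e)

  round-exposed : ∀ {V W} → Exposed V W →
                  Exposed (proj₁ (round G Q V W)) (proj₂ (round G Q V W))
  round-exposed {V} {W} exposed x b ¬q with to (boundary⇔ G) b
  ... | (¬kept , v , kept , e) with T? (V x)
  ...   | yes x∈V = from round-collected ((x∈V , round-removed x∈V ¬kept) , ¬q)
  ...   | no  x∉V =
    let (v∈V , ¬adj) = to round-kept kept in
    ⊥-elim (¬adj (x , exposed x (from (boundary⇔ G) (x∉V , v , v∈V , e)) ¬q , E-symᵀ G e))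

  exposed-final : ∀ {V W} → Exposed V W → isEmpty W ≡ true → boundary G V ⊆ Q
  exposed-final exposed empty x b with T? (Q x)
  ... | yes q  = q
  ... | no  ¬q = ⊥-elim (isEmpty≡true⇒∉ empty x (exposed x b ¬q))

  module _ {A : LSet k} (∂A⊆Q : boundary G A ⊆ Q) where

    Guarded : LSet k → LSet k → Set
    Guarded V W = A ⊆ V × Disjoint W A × Disjoint W Q

    guarded⇒¬Adjacent : ∀ {V W} → Guarded V W → ∀ a → T (A a) → ¬ Adjacent G W a
    guarded⇒¬Adjacent (_ , W∩A , W∩Q) a a∈A (u , w , e) =
      W∩Q u w (∂A⊆Q u (from (boundary⇔ G) (W∩A u w , a , a∈A , E-symᵀ G e)))

    round-guarded : ∀ {V W} → Guarded V W →
                    Guarded (proj₁ (round G Q V W)) (proj₂ (round G Q V W))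
    round-guarded guarded@(A⊆V , _ , _) =
      (λ a a∈A → from round-kept (A⊆V a a∈A , guarded⇒¬Adjacent guarded a a∈A)) ,
      (λ x c x∈A → guarded⇒¬Adjacent guarded x x∈A (proj₂ (proj₁ (to round-collected c)))) ,
      (λ x c → proj₂ (to round-collected c))

  peel-complete : ∀ {A V} → A ⊆ V → boundary G A ⊆ Q → A ⊆ peel V
  peel-complete {A} {V} A⊆V ∂A⊆Q =
    proj₁ (proj₁ (proj₂ (peel-invariant (Guarded ∂A⊆Q) (round-guarded ∂A⊆Q) V initial)))
    where
    initial : Guarded ∂A⊆Q V (boundary G (λ l → Q l ∨ V l))
    initial = A⊆V
            , (λ x b x∈A → proj₁ (to (boundary⇔ G) b) (from T-∨ (inj₂ (A⊆V x x∈A))))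
            , (λ x b q → proj₁ (to (boundary⇔ G) b) (from T-∨ (inj₁ q)))

  peel-sound : ∀ V → peel V ⊆ V × boundary G (peel V) ⊆ Q
  peel-sound V =
    let (_ , (peel⊆V , exposed) , empty) =
          peel-invariant (λ V′ W → V′ ⊆ V × Exposed V′ W)
            (λ (V′⊆V , exposed) →
               (λ x kept → V′⊆V x (proj₁ (to round-kept kept))) , round-exposed exposed)
            V ((λ _ x∈V → x∈V) , exposed-initial V)
    in peel⊆V , exposed-final exposed empty

  peel-greatest : ∀ V x → T (peel V x) ⇔ (∃[ A ] A ⊆ V × boundary G A ⊆ Q × T (A x))
  peel-greatest V x = mk⇔
    (λ r → peel V , proj₁ (peel-sound V) , proj₂ (peel-sound V) , r)
    (λ (A , A⊆V , ∂A⊆Q , x∈A) → peel-complete A⊆V ∂A⊆Q x x∈A)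

module Surround {k} (G : WGraph k) (d : Fin k → Fin k → Dist) (s₁ s₂ : Fin k → ℚ → Bool)
         (d₁ d₂ : ℚ) (ℓ : Fin k) where

  boolSurroundAt-correct : ∀ t →
    T (boolSurroundAt G d s₁ s₂ d₁ d₂ ℓ t) ⇔ SurroundSat G d s₁ s₂ d₁ d₂ t ℓ
  boolSurroundAt-correct t = mk⇔
    (λ r → let (A , A⊆V , ∂A⊆Q , ℓ∈A) = to (peel-greatest V ℓ) r in
           A , (λ l x → proj₁ (to T-∧ (A⊆V l x))) , ℓ∈A , (λ l x → proj₂ (to T-∧ (A⊆V l x)))
             , (λ l b → proj₁ (to T-∧ (∂A⊆Q l b))) , (λ l b → proj₂ (to T-∧ (∂A⊆Q l b))))
    (λ (A , inRange₀ , ℓ∈A , sat₁ , ∂inRange , sat₂) →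
       from (peel-greatest V ℓ)
         ( A , (λ l x → from T-∧ (inRange₀ l x , sat₁ l x))
         , (λ l b → from T-∧ (∂inRange l b , sat₂ l b)) , ℓ∈A ))
    where
    V : LSet k
    V l = inRange d ℓ 0ℚ d₂ l ∧ s₁ l t
    open Peeling G (λ l → inRange d ℓ d₁ d₂ l ∧ s₂ l t)

  inRange-weaken : 0ℚ ≤ d₁ → ∀ l → T (inRange d ℓ d₁ d₂ l) → T (inRange d ℓ 0ℚ d₂ l)
  inRange-weaken 0≤d₁ l r with d ℓ l
  ... | ∞     = r
  ... | fin δ = let (d₁≤δ , δ≤d₂) = to (T-∧ {⌊ d₁ ℚ.≤? δ ⌋}) r in
                from (T-∧ {⌊ 0ℚ ℚ.≤? δ ⌋}) (fromWitness (ℚ.≤-trans 0≤d₁ (toWitness d₁≤δ)) , δ≤d₂)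

  SurroundSat-transport : 0ℚ ≤ d₁ → ∀ {t t′} →
    (∀ l → T (inRange d ℓ 0ℚ d₂ l) → s₁ l t ≡ s₁ l t′ × s₂ l t ≡ s₂ l t′) →
    SurroundSat G d s₁ s₂ d₁ d₂ t ℓ → SurroundSat G d s₁ s₂ d₁ d₂ t′ ℓ
  SurroundSat-transport 0≤d₁ agree (A , inRange₀ , ℓ∈A , sat₁ , ∂inRange , sat₂) =
    A , inRange₀ , ℓ∈A , (λ l x → subst T (proj₁ (agree l (inRange₀ l x))) (sat₁ l x)) , ∂inRange
    , (λ l b → subst T (proj₂ (agree l (inRange-weaken 0≤d₁ l (∂inRange l b)))) (sat₂ l b))

lo∈lookup : ∀ {k d s₁ s₂ d₂ ℓ Tm cov} → IsConsistentCovering {k} d s₁ s₂ d₂ ℓ Tm cov →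
            ∀ i → lo (lookup cov i) ∈I[ Tm ] lookup cov i
lo∈lookup consistent i =
  let ((0≤a , a≤Tm) , a<b) = IsConsistentCovering.wf consistent i in
  (0≤a , a≤Tm) , ℚ.≤-refl , a<b

theorem4p2 : ∀ {k} (G : WGraph k) (d : Fin k → Fin k → Dist) → IsShortestDist G d →
    (s₁ s₂ : Fin k → ℚ → Bool) (d₁ d₂ Tm : ℚ) → 0ℚ ≤ d₁ → d₁ ≤ d₂ →
    (ℓ : Fin k) (cov : List Interval) → IsMinimalCovering d s₁ s₂ d₂ ℓ Tm cov →
    (i : Fin (length cov)) →
    T (sψ G d s₁ s₂ d₁ d₂ ℓ (lookup cov i))
      ⇔ (∀ t → t ∈I[ Tm ] lookup cov i → SurroundSat G d s₁ s₂ d₁ d₂ t ℓ)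
theorem4p2 G d _ s₁ s₂ d₁ d₂ Tm 0≤d₁ _ ℓ cov (consistent , _) i = mk⇔
  (λ ψ t t∈I → SurroundSat-transport 0≤d₁ (λ l r → constant i l r _ t lo∈I t∈I)
                 (to (boolSurroundAt-correct _) ψ))
  (λ sat → from (boolSurroundAt-correct _) (sat _ lo∈I))
  where
  open Surround G d s₁ s₂ d₁ d₂ ℓ
  open IsConsistentCovering consistent using (constant)
  lo∈I : lo (lookup cov i) ∈I[ Tm ] lookup cov i
  lo∈I = lo∈lookup consistent i
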